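{- For every integer $n\ge 7$, $$b(C(n;1,3)) = \left\lfloor \frac{2+\sqrt{3n-2}}{3}\right\rfloor + 1.$$
   Context: For an integer $n$ and positive integers $s_1<\dots<s_t\le n/2$, the circulant graph $C(n;s_1,\dots,s_t)$ has vertex set $\mathbb Z_n$, with distinct vertices $x,y$ adjacent iff $x-y \equiv \pm s_i \pmod n$ for some $i$. For a finite connected graph $G$, let $N_\ell[x]=\{y: d(x,y)\le \ell\}$. A sequence of vertices $(x_1,\dots,x_k)$ is a burning sequence of $G$ if $N_{k-1}[x_1]\cup N_{k-2}[x_2]\cup\cdots\cup N_0[x_k]=V(G)$; the burning number $b(G)$ is the minimum length of a burning sequence of $G$. -}

module Defs where

open import Data.Nat using (ℕ; zero; suc; _+_; _*_; _∸_; _≤_; _≤?_)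
open import Data.Fin using (Fin; toℕ)
open import Data.Vec using (Vec; lookup)
open import Data.List using (List; _∷_; [])
open import Data.List.Membership.Propositional using (_∈_)
open import Data.Product using (Σ; ∃; _×_)
open import Data.Sum using (_⊎_)
open import Relation.Nullary using (¬_; does)
open import Relation.Binary.PropositionalEquality using (_≡_; _≢_)
open import Data.Bool using (if_then_else_)

isqrt : ℕ → ℕ
isqrt zero = zero
isqrt (suc N) with isqrt N
... | s = if does (suc s * suc s ≤? suc N) then suc s else s

-- x ≡ y + s (mod n), for x y < n and s < n, i.e. x = y + s or x + n = y + s
-- (vertices of C(n;S) are Fin n, identified with Z_n via toℕ)
ShiftBy : (n s : ℕ) → Fin n → Fin n → Set
ShiftBy n s x y = (toℕ y + s ≡ toℕ x) ⊎ (toℕ y + s ≡ toℕ x + n)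

CircAdj : (n : ℕ) → List ℕ → Fin n → Fin n → Set
CircAdj n S x y = x ≢ y × Σ ℕ (λ s → s ∈ S × (ShiftBy n s x y ⊎ ShiftBy n s y x))

-- Within Adj ℓ x y : d(x,y) ≤ ℓ, i.e. y ∈ N_ℓ[x]  (there is a walk of length ≤ ℓ)
data Within {V : Set} (Adj : V → V → Set) : ℕ → V → V → Set where
  here : ∀ {ℓ x} → Within Adj ℓ x x
  step : ∀ {ℓ x z y} → Adj x z → Within Adj ℓ z y → Within Adj (suc ℓ) x y

-- (x_1,…,x_k) (stored 0-indexed) is a burning sequence:
-- N_{k-1}[x_1] ∪ … ∪ N_0[x_k] = V
IsBurningSeq : {V : Set} (Adj : V → V → Set) (k : ℕ) → Vec V k → Set
IsBurningSeq {V} Adj k xs =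
  ∀ (v : V) → Σ (Fin k) (λ i → Within Adj (k ∸ suc (toℕ i)) (lookup xs i) v)

IsBurningNumber : {V : Set} (Adj : V → V → Set) → ℕ → Set
IsBurningNumber {V} Adj k =
  Σ (Vec V k) (IsBurningSeq Adj k) ×
  (∀ (k′ : ℕ) (xs : Vec V k′) → IsBurningSeq Adj k′ xs → k ≤ k′)

-- A ball of radius r in C(n;1,3) consists of the vertices at displacement d from its centre
-- with |d| ≤ 3r and |d| ≠ 3r − 1, so it has 6r − 1 vertices when r ≥ 1. The balls of a
-- burning sequence of length k therefore cover at most G(k) = 3(k−1)² + 2(k−1) + 1 vertices,
-- and they cannot cover exactly G(k) of them: in such an exact cover the radius-0 ball {σ} is
-- isolated, and a case analysis of how the neighbouring balls meet σ − 5, …, σ + 3 always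
-- produces an overlap. Conversely, balls of radii k − 1, …, 0 placed side by side so that
-- consecutive balls fill each other's gaps cover G(k) − 1 consecutive vertices. Hence
-- b(C(n;1,3)) = q + 1 for the q with G(q) ≤ n < G(q + 1), and this q is ⌊(2 + ⌊√(3n − 2)⌋)/3⌋.
module Submission where

open import Defs
open import Data.Bool using (T; true; false)
open import Data.Empty using (⊥; ⊥-elim)
open import Data.Fin using (Fin; toℕ; fromℕ) renaming (zero to fzero; suc to fsuc)
import Data.Fin.Properties as Fin
open import Data.List using (List; _∷_; []; _++_; length; map; applyUpTo)
import Data.List as List
open import Data.List.Membership.Propositional using (_∈_)
open import Data.List.Membership.Propositional.Properties using (∈-map⁺; ∈-++⁺ˡ; ∈-++⁺ʳ; ∈-++⁻; ∈-applyUpTo⁺; ∈-∃++)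
open import Data.List.Properties using (length-++; length-map; length-applyUpTo)
import Data.List.Relation.Unary.Any as Any
open import Data.List.Relation.Unary.Any using (here; there)
open import Data.List.Relation.Unary.Any.Properties using (lookup-index)
open import Data.Nat using (ℕ; zero; suc; _+_; _*_; _∸_; _≤_; _<_; _%_; _<ᵇ_; NonZero; s≤s; z≤n; _<?_; _≤?_)
open import Data.Nat.DivMod using (_mod_; _/_; m≡m%n+[m/n]*n; m/n*n≤m; m%n<n; [m+kn]%n≡m%n; [m+n]%n≡m%n; %-distribˡ-+; m<n⇒m%n≡m)
open import Data.Nat.Properties
open import Data.Nat.Tactic.RingSolver using (solve)
open import Data.Product using (Σ; _×_; _,_; _,′_; proj₁; proj₂)
import Data.Product as Product
open import Data.Product.Properties using (,-injectiveˡ; ,-injectiveʳ)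
open import Data.Sum using (_⊎_; inj₁; inj₂; [_,_]′; swap)
import Data.Sum as Sum
open import Data.Vec using (Vec; lookup) renaming ([] to []ᵥ; _∷_ to _∷ᵥ_)
open import Function using (_∘_)
open import Relation.Binary.Definitions using (tri<; tri≈; tri>)
open import Relation.Binary.PropositionalEquality using (_≡_; _≢_; refl; sym; trans; ≢-sym; cong; cong₂; subst; subst₂; module ≡-Reasoning)
open import Relation.Nullary using (¬_; yes; no)

m<n+n⇒m%n≡m∨m%n+n≡m : ∀ {m n} .{{_ : NonZero n}} → m < n + n → m % n ≡ m ⊎ m % n + n ≡ m
m<n+n⇒m%n≡m∨m%n+n≡m {m} {n} m<2n with m <? n
... | yes m<n = inj₁ (m<n⇒m%n≡m m<n)
... | no  m≮n = inj₂ (begin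
  m % n + n             ≡⟨ cong (λ x → x % n + n) (m∸n+n≡m n≤m) ⟨
  (m ∸ n + n) % n + n   ≡⟨ cong (_+ n) ([m+n]%n≡m%n (m ∸ n) n) ⟩
  (m ∸ n) % n + n       ≡⟨ cong (_+ n) (m<n⇒m%n≡m (m<n+o⇒m∸n<o m n m<2n)) ⟩
  m ∸ n + n             ≡⟨ m∸n+n≡m n≤m ⟩
  m                     ∎)
  where
    open ≡-Reasoning
    n≤m = ≮⇒≥ m≮n

m+o≡n⇒m≤n : ∀ {m n} o → m + o ≡ n → m ≤ n
m+o≡n⇒m≤n o refl = m≤m+n _ o

m<n∧n+o≡m+p⇒o<p : ∀ {m n o p} → m < n → n + o ≡ m + p → o < p
m<n∧n+o≡m+p⇒o<p {m} {n} {o} {p} m<n eq = +-cancelˡ-≤ m (suc o) p (begin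
  m + suc o   ≡⟨ +-suc m o ⟩
  suc m + o   ≤⟨ +-monoˡ-≤ o m<n ⟩
  n + o       ≡⟨ eq ⟩
  m + p       ∎)
  where open ≤-Reasoning

-- Arithmetic in ℤ/n

module Cyclic (m : ℕ) where
  open ≡-Reasoning

  n : ℕ
  n = suc m

  infix 5 _⊖_

  -- a ⊖ b is a − b in ℤ/n, kept inside ℕ by reading m as −1 (mod n).
  opaque
    _⊖_ : ℕ → ℕ → Fin n
    a ⊖ b = (a + b * m) mod n

    toℕ-⊖ : ∀ a b → toℕ (a ⊖ b) ≡ (a + b * m) % n
    toℕ-⊖ a b = Fin.toℕ-fromℕ< (m%n<n (a + b * m) n)

  %≡%⇒⊖≡⊖ : ∀ {a b a′ b′} → (a + b * m) % n ≡ (a′ + b′ * m) % n → a ⊖ b ≡ a′ ⊖ b′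
  %≡%⇒⊖≡⊖ {a} {b} {a′} {b′} e = Fin.toℕ-injective (trans (toℕ-⊖ a b) (trans e (sym (toℕ-⊖ a′ b′))))

  ⊖≡⊖⇒%≡% : ∀ {a b a′ b′} → a ⊖ b ≡ a′ ⊖ b′ → (a + b * m) % n ≡ (a′ + b′ * m) % n
  ⊖≡⊖⇒%≡% {a} {b} {a′} {b′} e = trans (sym (toℕ-⊖ a b)) (trans (cong toℕ e) (toℕ-⊖ a′ b′))

  ⊖-cong : ∀ {a b a′ b′} → a + b′ ≡ a′ + b → a ⊖ b ≡ a′ ⊖ b′
  ⊖-cong {a} {b} {a′} {b′} e = %≡%⇒⊖≡⊖ (begin
    (a + b * m) % n              ≡⟨ [m+kn]%n≡m%n (a + b * m) b′ n ⟨
    (a + b * m + b′ * n) % n     ≡⟨ cong (_% n) balance ⟩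
    (a′ + b′ * m + b * n) % n    ≡⟨ [m+kn]%n≡m%n (a′ + b′ * m) b n ⟩
    (a′ + b′ * m) % n            ∎)
    where
      balance : a + b * m + b′ * suc m ≡ a′ + b′ * m + b * suc m
      balance = begin
        a + b * m + b′ * suc m     ≡⟨ solve (a ∷ b ∷ b′ ∷ m ∷ []) ⟩
        (a + b′) + (b + b′) * m    ≡⟨ cong (_+ (b + b′) * m) e ⟩
        (a′ + b) + (b + b′) * m    ≡⟨ solve (a′ ∷ b ∷ b′ ∷ m ∷ []) ⟩
        a′ + b′ * m + b * suc m    ∎

  ⊖-translate : ∀ {a b a′ b′} x y → a ⊖ b ≡ a′ ⊖ b′ → a + x ⊖ b + y ≡ a′ + x ⊖ b′ + y
  ⊖-translate {a} {b} {a′} {b′} x y e = %≡%⇒⊖≡⊖ (begin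
    (a + x + (b + y) * m) % n                  ≡⟨ cong (_% n) (regroup a b) ⟩
    ((a + b * m) + (x + y * m)) % n            ≡⟨ %-distribˡ-+ (a + b * m) (x + y * m) n ⟩
    ((a + b * m) % n + (x + y * m) % n) % n    ≡⟨ cong (λ r → (r + (x + y * m) % n) % n) (⊖≡⊖⇒%≡% e) ⟩
    ((a′ + b′ * m) % n + (x + y * m) % n) % n  ≡⟨ %-distribˡ-+ (a′ + b′ * m) (x + y * m) n ⟨
    ((a′ + b′ * m) + (x + y * m)) % n          ≡⟨ cong (_% n) (regroup a′ b′) ⟨
    (a′ + x + (b′ + y) * m) % n                ∎)
    where
      regroup : ∀ c d → c + x + (d + y) * m ≡ (c + d * m) + (x + y * m)
      regroup c d = solve (c ∷ d ∷ x ∷ y ∷ m ∷ [])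

  ⊖-+n : ∀ a b → a + n ⊖ b ≡ a ⊖ b
  ⊖-+n a b = %≡%⇒⊖≡⊖ (begin
    (a + n + b * m) % n      ≡⟨ cong (_% n) regroup ⟩
    (a + b * m + 1 * n) % n  ≡⟨ [m+kn]%n≡m%n (a + b * m) 1 n ⟩
    (a + b * m) % n          ∎)
    where
      regroup : a + suc m + b * m ≡ a + b * m + 1 * suc m
      regroup = solve (a ∷ b ∷ m ∷ [])

  toℕ-⊖0 : ∀ a → toℕ (a ⊖ 0) ≡ a % n
  toℕ-⊖0 a = trans (toℕ-⊖ a 0) (cong (_% n) (+-identityʳ a))

  toℕ⊖0 : ∀ (v : Fin n) → toℕ v ⊖ 0 ≡ v
  toℕ⊖0 v = Fin.toℕ-injective (trans (toℕ-⊖0 (toℕ v)) (m<n⇒m%n≡m (Fin.toℕ<n v)))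

  toℕ-⊖-+ : ∀ a b x y → toℕ (a ⊖ b) + x ⊖ y ≡ a + x ⊖ b + y
  toℕ-⊖-+ a b x y = ⊖-translate x y (toℕ⊖0 (a ⊖ b))

  ⊖-suc : ∀ {a x b a′ y b′} → a + x ⊖ b ≡ a′ + y ⊖ b′ → a + suc x ⊖ b ≡ a′ + suc y ⊖ b′
  ⊖-suc {a} {x} {b} {a′} {y} {b′} e =
    trans (⊖-cong (regroup a x b)) (trans (⊖-translate 1 0 e) (⊖-cong (sym (regroup a′ y b′))))
    where
      regroup : ∀ c z d → c + suc z + (d + 0) ≡ c + z + 1 + d
      regroup c z d = solve (c ∷ z ∷ d ∷ [])

  ⊖-pred : ∀ {a x b a′ y b′} → a + suc x ⊖ b ≡ a′ + suc y ⊖ b′ → a + x ⊖ b ≡ a′ + y ⊖ b′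
  ⊖-pred {a} {x} {b} {a′} {y} {b′} e =
    trans (⊖-cong (regroup a x b)) (trans (⊖-translate 0 1 e) (⊖-cong (sym (regroup a′ y b′))))
    where
      regroup : ∀ c z d → c + z + (d + 1) ≡ c + suc z + 0 + d
      regroup c z d = solve (c ∷ z ∷ d ∷ [])

  ⊖-as-⊖0 : ∀ a b → a ⊖ b ≡ a + b * m ⊖ 0
  ⊖-as-⊖0 a b = %≡%⇒⊖≡⊖ (cong (_% n) (sym (+-identityʳ (a + b * m))))

  shiftBy-⊖ : ∀ a s → s < n → ShiftBy n s (a + s ⊖ 0) (a ⊖ 0)
  shiftBy-⊖ a s s<n = Sum.map
    (λ e → begin
      toℕ (a ⊖ 0) + s    ≡⟨ cong (_+ s) (toℕ-⊖0 a) ⟩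
      a % n + s          ≡⟨ e ⟨
      (a % n + s) % n    ≡⟨ toℕ-sum ⟨
      toℕ (a + s ⊖ 0)    ∎)
    (λ e → begin
      toℕ (a ⊖ 0) + s        ≡⟨ cong (_+ s) (toℕ-⊖0 a) ⟩
      a % n + s              ≡⟨ e ⟨
      (a % n + s) % n + n    ≡⟨ cong (_+ n) toℕ-sum ⟨
      toℕ (a + s ⊖ 0) + n    ∎)
    (m<n+n⇒m%n≡m∨m%n+n≡m (+-mono-< (m%n<n a n) s<n))
    where
      toℕ-sum : toℕ (a + s ⊖ 0) ≡ (a % n + s) % n
      toℕ-sum = begin
        toℕ (a + s ⊖ 0)          ≡⟨ toℕ-⊖0 (a + s) ⟩
        (a + s) % n              ≡⟨ %-distribˡ-+ a s n ⟩
        (a % n + s % n) % n      ≡⟨ cong (λ r → (a % n + r) % n) (m<n⇒m%n≡m s<n) ⟩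
        (a % n + s) % n          ∎

  ⊖-shift-≢ : ∀ a b s → .{{NonZero s}} → s < n → a ⊖ b ≢ a + s ⊖ b
  ⊖-shift-≢ a b s@(suc _) s<n eq =
    [ (λ e → m+1+n≢m (toℕ (c ⊖ 0)) (trans e (cong toℕ (sym eq′))))
    , (λ e → <⇒≢ s<n (+-cancelˡ-≡ (toℕ (c ⊖ 0)) s n (trans e (cong (_+ n) (cong toℕ (sym eq′))))))
    ]′ (shiftBy-⊖ c s s<n)
    where
      c : ℕ
      c = a + b * m
      regroup : ∀ x → a + x + b * m + 0 ≡ a + b * m + x + 0
      regroup x = solve (a ∷ x ∷ b ∷ m ∷ [])
      eq′ : c ⊖ 0 ≡ c + s ⊖ 0
      eq′ = begin
        c ⊖ 0              ≡⟨ ⊖-as-⊖0 a b ⟨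
        a ⊖ b              ≡⟨ eq ⟩
        a + s ⊖ b          ≡⟨ ⊖-as-⊖0 (a + s) b ⟩
        a + s + b * m ⊖ 0  ≡⟨ ⊖-cong (regroup s) ⟩
        c + s ⊖ 0          ∎

  shiftBy⇒⊖+ : ∀ {s x y} → ShiftBy n s x y → ∀ k → x ≡ toℕ y + (k + s) ⊖ k
  shiftBy⇒⊖+ {s} {x} {y} sh k = trans (sym (toℕ⊖0 x)) (trans (as-sum sh) (⊖-cong (regroup (toℕ y))))
    where
      regroup : ∀ a → a + s + k ≡ a + (k + s) + 0
      regroup a = solve (a ∷ s ∷ k ∷ [])
      as-sum : ShiftBy n s x y → toℕ x ⊖ 0 ≡ toℕ y + s ⊖ 0
      as-sum (inj₁ e) = cong (_⊖ 0) (sym e)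
      as-sum (inj₂ e) = trans (sym (⊖-+n (toℕ x) 0)) (cong (_⊖ 0) (sym e))

  shiftBy⇒⊖- : ∀ {s x y} → ShiftBy n s x y → ∀ k → y ≡ toℕ x + k ⊖ k + s
  shiftBy⇒⊖- {s} {x} {y} sh k = trans (as-difference sh) (⊖-cong (sym (+-assoc (toℕ x) k s)))
    where
      as-difference : ShiftBy n s x y → y ≡ toℕ x ⊖ s
      as-difference (inj₁ e) = trans (sym (toℕ⊖0 y)) (⊖-cong (trans e (sym (+-identityʳ (toℕ x)))))
      as-difference (inj₂ e) =
        trans (sym (toℕ⊖0 y)) (trans (⊖-cong (trans e (sym (+-identityʳ (toℕ x + n))))) (⊖-+n (toℕ x) s))

module _ {V : Set} {Adj : V → V → Set} where

  Within-snoc : ∀ {ℓ x y z} → Within Adj ℓ x y → Adj y z → Within Adj (suc ℓ) x z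
  Within-snoc here       a′ = step a′ here
  Within-snoc (step a w) a′ = step a (Within-snoc w a′)

  Within-sym : (∀ {x y} → Adj x y → Adj y x) → ∀ {ℓ x y} → Within Adj ℓ x y → Within Adj ℓ y x
  Within-sym sym-adj here       = here
  Within-sym sym-adj (step a w) = Within-snoc (Within-sym sym-adj w) (sym-adj a)

CircAdj-sym : ∀ {n S x y} → CircAdj n S x y → CircAdj n S y x
CircAdj-sym (x≢y , s , s∈S , shift) = (x≢y ∘ sym) , s , s∈S , swap shift

S₁₃ : List ℕ
S₁₃ = 1 ∷ 3 ∷ []

radius : ∀ {k} → Fin k → ℕ
radius {k} i = k ∸ suc (toℕ i)

-- Balls of C(n;1,3)

-- Offset r t: the displacement t − 3r lies in the ball of radius r of C(n;1,3), which
-- consists of the displacements in [−3r, 3r] other than ±(3r − 1).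
data Offset (r t : ℕ) : Set where
  leftEnd  : t ≡ 0 → Offset r t
  rightEnd : t ≡ 6 * r → Offset r t
  inner    : 2 ≤ t → t + 2 ≤ 6 * r → Offset r t

Offset-3r : ∀ r → Offset r (3 * r)
Offset-3r zero    = leftEnd refl
Offset-3r (suc r) = inner (m+o≡n⇒m≤n (1 + 3 * r) (solve (r ∷ []))) (m+o≡n⇒m≤n (1 + 3 * r) (solve (r ∷ [])))

data Move : Set where
  back₃ back₁ fwd₁ fwd₃ : Move

-- a move by δ ∈ {−3, −1, 1, 3} changes the encoded offset t of Offset by δ + 3
shift : Move → ℕ
shift back₃ = 0
shift back₁ = 2
shift fwd₁  = 4
shift fwd₃  = 6

shift≤6 : ∀ μ → shift μ ≤ 6
shift≤6 back₃ = z≤n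
shift≤6 back₁ = s≤s (s≤s z≤n)
shift≤6 fwd₁  = s≤s (s≤s (s≤s (s≤s z≤n)))
shift≤6 fwd₃  = ≤-refl

Offset-step : ∀ {r t} μ → Offset r t → Offset (suc r) (shift μ + t)
Offset-step         back₃ (leftEnd refl) = leftEnd refl
Offset-step {r}     back₁ (leftEnd refl) = inner ≤-refl (m+o≡n⇒m≤n (2 + 6 * r) (solve (r ∷ [])))
Offset-step {r}     fwd₁  (leftEnd refl) = inner (m≤n+m 2 2) (m+o≡n⇒m≤n (6 * r) (solve (r ∷ [])))
Offset-step {zero}  fwd₃  (leftEnd refl) = rightEnd refl
Offset-step {suc r} fwd₃  (leftEnd refl) = inner (m≤n+m 2 4) (m+o≡n⇒m≤n (4 + 6 * r) (solve (r ∷ [])))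
Offset-step {zero}  back₃ (rightEnd refl) = leftEnd refl
Offset-step {suc r} back₃ (rightEnd refl) = inner (m+o≡n⇒m≤n (4 + 6 * r) (solve (r ∷ []))) (m+o≡n⇒m≤n 4 (solve (r ∷ [])))
Offset-step {r}     back₁ (rightEnd refl) = inner (m≤m+n 2 (6 * r)) (m+o≡n⇒m≤n 2 (solve (r ∷ [])))
Offset-step {r}     fwd₁  (rightEnd refl) = inner (m≤m+n 2 (2 + 6 * r)) (≤-reflexive (solve (r ∷ [])))
Offset-step {r}     fwd₃  (rightEnd refl) = rightEnd (sym (*-suc 6 r))
Offset-step {r} {t} μ (inner 2≤t t+2≤6r) =
  inner (≤-trans 2≤t (m≤n+m t (shift μ))) (begin
    shift μ + t + 2    ≡⟨ +-assoc (shift μ) t 2 ⟩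
    shift μ + (t + 2)  ≤⟨ +-mono-≤ (shift≤6 μ) t+2≤6r ⟩
    6 + 6 * r          ≡⟨ *-suc 6 r ⟨
    6 * suc r          ∎)
  where open ≤-Reasoning

Offset0⇒t≡0 : ∀ {t} → Offset 0 t → t ≡ 0
Offset0⇒t≡0     (leftEnd t≡0)  = t≡0
Offset0⇒t≡0     (rightEnd t≡0) = t≡0
Offset0⇒t≡0 {t} (inner _ t+2≤0) with () ← m+n≤o⇒n≤o t t+2≤0

Offset-2 : ∀ {r} → 1 ≤ r → Offset r 2
Offset-2 {suc r} _ = inner ≤-refl (m+o≡n⇒m≤n (2 + 6 * r) (solve (r ∷ [])))

Offset-3 : ∀ {r} → 1 ≤ r → Offset r 3
Offset-3 {suc r} _ = inner (n≤1+n 2) (m+o≡n⇒m≤n (1 + 6 * r) (solve (r ∷ [])))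

Offset-6r-2 : ∀ x → Offset (suc x) (4 + 6 * x)
Offset-6r-2 x = inner (m≤m+n 2 (2 + 6 * x)) (≤-reflexive (solve (x ∷ [])))

Offset-6r-3 : ∀ x → Offset (suc x) (3 + 6 * x)
Offset-6r-3 x = inner (m≤m+n 2 (1 + 6 * x)) (m+o≡n⇒m≤n 1 (solve (x ∷ [])))

¬Offset-1 : ∀ {r} → ¬ Offset r 1
¬Offset-1 {zero}  (rightEnd ())
¬Offset-1 {suc r} (rightEnd 1≡6r+6) = 0≢1+n (suc-injective (trans 1≡6r+6 (*-suc 6 r)))
¬Offset-1         (inner (s≤s ()) _)

¬Offset-6r+1 : ∀ {r} → ¬ Offset r (suc (6 * r))
¬Offset-6r+1     (rightEnd e)      = 1+n≢n e
¬Offset-6r+1 {r} (inner _ 6r+3≤6r) = 1+n≰n (≤-trans (m≤m+n _ 2) 6r+3≤6r)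

¬Offset-6r+2 : ∀ {r} → ¬ Offset r (2 + 6 * r)
¬Offset-6r+2 {r} (rightEnd e)      = m≢1+n+m (6 * r) {1} (sym e)
¬Offset-6r+2      (inner _ 6r+4≤6r) = 1+n≰n (≤-trans (≤-trans (n≤1+n _) (m≤m+n _ 2)) 6r+4≤6r)

Offset⇒suc≢6r : ∀ {r t} → Offset r t → suc t ≢ 6 * r
Offset⇒suc≢6r {r} (leftEnd refl)        = ¬Offset-1 {r} ∘ rightEnd
Offset⇒suc≢6r (rightEnd refl)           = 1+n≢n
Offset⇒suc≢6r {t = t} (inner _ t+2≤6r) e = 1+n≰n (≤-trans (≤-reflexive (+-comm 2 t)) (subst (t + 2 ≤_) (sym e) t+2≤6r))

data Below₂ (r : ℕ) : ℕ → Set where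
  bottom : Below₂ r 0
  down₁  : ∀ {t} → Offset r t → Below₂ r (suc t)
  down₂  : ∀ {t} → Offset r t → Below₂ r (suc (suc t))

below₂ : ∀ {r t} → Offset r t → Below₂ r t
below₂           (leftEnd refl)  = bottom
below₂ {zero}    (rightEnd refl) = bottom
below₂ {suc x}   (rightEnd refl) = subst (Below₂ (suc x)) 2+[6x+4]≡6[x+1] (down₂ (Offset-6r-2 x))
  where
    2+[6x+4]≡6[x+1] : 2 + (4 + 6 * x) ≡ 6 * suc x
    2+[6x+4]≡6[x+1] = solve (x ∷ [])
below₂ {t = 1}   (inner (s≤s ()) _)
below₂ {t = 2}   (inner _ _)     = down₂ (leftEnd refl)
below₂ {t = suc (suc (suc t))} (inner _ t+5≤6r) = down₁ (inner (s≤s (s≤s z≤n)) (≤-trans (n≤1+n _) t+5≤6r))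

data Above₂ (r t : ℕ) : Set where
  top : t ≡ 6 * r → Above₂ r t
  up₁ : Offset r (suc t) → Above₂ r t
  up₂ : Offset r (suc (suc t)) → Above₂ r t

above₂ : ∀ {r t} → Offset r t → Above₂ r t
above₂ {zero}  (leftEnd refl) = top refl
above₂ {suc r} (leftEnd refl) = up₂ (Offset-2 (s≤s z≤n))
above₂         (rightEnd e)   = top e
above₂ {r} {t} (inner 2≤t t+2≤6r) with suc t + 2 ≤? 6 * r
... | yes t+3≤6r = up₁ (inner (≤-trans 2≤t (n≤1+n t)) t+3≤6r)
... | no  t+3≰6r = up₂ (rightEnd (trans (+-comm 2 t) (≤-antisym t+2≤6r (≤-pred (≰⇒> t+3≰6r)))))

data Below₁ (r : ℕ) : ℕ → Set where
  atLeftEnd  : Below₁ r 0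
  atGap      : Below₁ r 2
  atRightEnd : Below₁ r (6 * r)
  down₁      : ∀ {t} → Offset r t → Below₁ r (suc t)

below₁ : ∀ {r t} → Offset r t → Below₁ r t
below₁ (leftEnd refl)  = atLeftEnd
below₁ (rightEnd refl) = atRightEnd
below₁ {t = 1} (inner (s≤s ()) _)
below₁ {t = 2} (inner _ _) = atGap
below₁ {t = suc (suc (suc t))} (inner _ t+5≤6r) = down₁ (inner (s≤s (s≤s z≤n)) (≤-trans (n≤1+n _) t+5≤6r))

ballSize : ℕ → ℕ
ballSize zero    = 1
ballSize (suc r) = 6 * r + 5

coverSize : ℕ → ℕ
coverSize zero    = 0
coverSize (suc k) = ballSize k + coverSize k

coverSize-closed : ∀ q → coverSize (suc q) ≡ 3 * q * q + 2 * q + 1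
coverSize-closed zero    = refl
coverSize-closed (suc q) = begin
  6 * q + 5 + coverSize (suc q)            ≡⟨ cong (6 * q + 5 +_) (coverSize-closed q) ⟩
  6 * q + 5 + (3 * q * q + 2 * q + 1)      ≡⟨ solve (q ∷ []) ⟩
  3 * suc q * suc q + 2 * suc q + 1        ∎
  where open ≡-Reasoning

-- the centre of the ball of radius ρ + 1 in the explicit burning sequence
centre : ℕ → ℕ
centre ρ = 3 * ρ * ρ + 5 * ρ + 3

centre-reach : ∀ ρ → centre ρ + suc ρ * 3 ≡ coverSize (2 + ρ)
centre-reach ρ = begin
  3 * ρ * ρ + 5 * ρ + 3 + suc ρ * 3   ≡⟨ solve (ρ ∷ []) ⟩
  3 * suc ρ * suc ρ + 2 * suc ρ + 1   ≡⟨ coverSize-closed (suc ρ) ⟨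
  coverSize (2 + ρ)                   ∎
  where open ≡-Reasoning

centre-suc : ∀ ρ → coverSize (2 + ρ) + (3 * ρ + 5) ≡ centre (suc ρ)
centre-suc ρ = begin
  coverSize (2 + ρ) + (3 * ρ + 5)                   ≡⟨ cong (_+ (3 * ρ + 5)) (coverSize-closed (suc ρ)) ⟩
  3 * suc ρ * suc ρ + 2 * suc ρ + 1 + (3 * ρ + 5)   ≡⟨ solve (ρ ∷ []) ⟩
  3 * suc ρ * suc ρ + 5 * suc ρ + 3                 ∎
  where open ≡-Reasoning

ballSize-mono : ∀ {r r′} → r ≤ r′ → ballSize r ≤ ballSize r′
ballSize-mono {zero}  {zero}   _          = ≤-refl
ballSize-mono {zero}  {suc r′} _          = ≤-trans (s≤s z≤n) (m≤n+m 5 (6 * r′))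
ballSize-mono {suc r} {suc r′} (s≤s r≤r′) = +-monoˡ-≤ 5 (*-monoʳ-≤ 6 r≤r′)

coverSize-mono : ∀ {k k′} → k ≤ k′ → coverSize k ≤ coverSize k′
coverSize-mono z≤n        = z≤n
coverSize-mono (s≤s k≤k′) = +-mono-≤ (ballSize-mono k≤k′) (coverSize-mono k≤k′)

module Circulant (m : ℕ) where
  open Cyclic m

  Adj : Fin n → Fin n → Set
  Adj = CircAdj n S₁₃

  Within-reverse : ∀ {ℓ x y} → Within Adj ℓ x y → Within Adj ℓ y x
  Within-reverse = Within-sym (λ {x} {y} → CircAdj-sym {n} {S₁₃} {x} {y})

  adjacent⇒move : ∀ {x z} → Adj x z → Σ Move λ μ → z ≡ toℕ x + shift μ ⊖ 3
  adjacent⇒move (_ , _ , here refl ,         inj₁ x=z+1) = back₁ , shiftBy⇒⊖- x=z+1 2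
  adjacent⇒move (_ , _ , here refl ,         inj₂ z=x+1) = fwd₁  , shiftBy⇒⊖+ z=x+1 3
  adjacent⇒move (_ , _ , there (here refl) , inj₁ x=z+3) = back₃ , shiftBy⇒⊖- x=z+3 0
  adjacent⇒move (_ , _ , there (here refl) , inj₂ z=x+3) = fwd₃  , shiftBy⇒⊖+ z=x+3 3

  within⇒Offset : ∀ {ℓ c v} → Within Adj ℓ c v → Σ ℕ λ t → Offset ℓ t × v ≡ toℕ c + t ⊖ 3 * ℓ
  within⇒Offset {ℓ} {c} here =
    3 * ℓ , Offset-3r ℓ , trans (sym (toℕ⊖0 c)) (⊖-cong (sym (+-identityʳ (toℕ c + 3 * ℓ))))
  within⇒Offset {suc ℓ} {c} {v} (step {z = z} c~z w) with adjacent⇒move c~z | within⇒Offset w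
  ... | μ , z≡ | t , off , v≡ = shift μ + t , Offset-step μ off , (begin
      v                                        ≡⟨ v≡ ⟩
      toℕ z + t ⊖ 3 * ℓ                        ≡⟨ cong (λ y → toℕ y + t ⊖ 3 * ℓ) z≡ ⟩
      toℕ (toℕ c + shift μ ⊖ 3) + t ⊖ 3 * ℓ    ≡⟨ toℕ-⊖-+ (toℕ c + shift μ) 3 t (3 * ℓ) ⟩
      toℕ c + shift μ + t ⊖ 3 + 3 * ℓ          ≡⟨ ⊖-cong (regroup (toℕ c) (shift μ)) ⟩
      toℕ c + (shift μ + t) ⊖ 3 * suc ℓ        ∎)
    where
      open ≡-Reasoning
      regroup : ∀ a d → a + d + t + 3 * suc ℓ ≡ a + (d + t) + (3 + 3 * ℓ)
      regroup a d = solve (a ∷ d ∷ t ∷ ℓ ∷ [])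

  module _ (6≤m : 6 ≤ m) where

    adj-+ : ∀ a s → s ∈ S₁₃ → .{{_ : NonZero s}} → s < n → Adj (a ⊖ 0) (a + s ⊖ 0)
    adj-+ a s s∈S s<n = ⊖-shift-≢ a 0 s s<n , s , s∈S , inj₂ (shiftBy-⊖ a s s<n)

    adj₁ : ∀ a → Adj (a ⊖ 0) (a + 1 ⊖ 0)
    adj₁ a = adj-+ a 1 (here refl) (s≤s (≤-trans (s≤s z≤n) 6≤m))

    adj₃ : ∀ a → Adj (a ⊖ 0) (a + 3 ⊖ 0)
    adj₃ a = adj-+ a 3 (there (here refl)) (s≤s (≤-trans (s≤s (s≤s (s≤s z≤n))) 6≤m))

    walk : ∀ s → (∀ a → Adj (a ⊖ 0) (a + s ⊖ 0)) → ∀ j a → Within Adj j (a ⊖ 0) (a + j * s ⊖ 0)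
    walk s adj zero    a = subst (λ b → Within Adj 0 (a ⊖ 0) (b ⊖ 0)) (sym (+-identityʳ a)) here
    walk s adj (suc j) a = step (adj a)
      (subst (λ b → Within Adj j (a + s ⊖ 0) (b ⊖ 0)) (+-assoc a s (j * s)) (walk s adj j (a + s)))

    Within-+ : ∀ R d a → d + 2 ≤ 3 * R → Within Adj R (a ⊖ 0) (a + d ⊖ 0)
    Within-+ R zero a _ = subst (λ b → Within Adj R (a ⊖ 0) (b ⊖ 0)) (sym (+-identityʳ a)) here
    Within-+ (suc R) 1 a _ = step (adj₁ a) here
    Within-+ (suc zero) 2 a (s≤s (s≤s (s≤s ())))
    Within-+ (suc (suc R)) 2 a _ =
      step (adj₃ a) (step (CircAdj-sym (subst (λ b → Adj (a + 2 ⊖ 0) (b ⊖ 0)) (+-assoc a 2 1) (adj₁ (a + 2)))) here)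
    Within-+ (suc R) (suc (suc (suc d))) a d+5≤3R+3 =
      step (adj₃ a) (subst (λ b → Within Adj R (a + 3 ⊖ 0) (b ⊖ 0)) (+-assoc a 3 d) (Within-+ R d (a + 3) d+2≤3R))
      where
        d+2≤3R : d + 2 ≤ 3 * R
        d+2≤3R = +-cancelˡ-≤ 3 (d + 2) (3 * R) (subst (3 + (d + 2) ≤_) (*-suc 3 R) d+5≤3R+3)

    BurnsBelow : ∀ k → Vec (Fin n) k → ℕ → Set
    BurnsBelow k xs N = ∀ p → suc p < N → Σ (Fin k) λ i → Within Adj (radius i) (lookup xs i) (p ⊖ 0)

    newBall-leftEnd : ∀ ρ {p} → suc p ≡ coverSize (2 + ρ) → Within Adj (2 + ρ) (centre (suc ρ) ⊖ 0) (p ⊖ 0)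
    newBall-leftEnd ρ {p} p+1≡E =
      subst (λ b → Within Adj (2 + ρ) (b ⊖ 0) (p ⊖ 0)) p+3r≡c (Within-reverse (walk 3 adj₃ (2 + ρ) p))
      where
        open ≡-Reasoning
        p+3r≡c : p + (2 + ρ) * 3 ≡ centre (suc ρ)
        p+3r≡c = begin
          p + (2 + ρ) * 3                  ≡⟨ solve (p ∷ ρ ∷ []) ⟩
          suc p + (3 * ρ + 5)              ≡⟨ cong (_+ (3 * ρ + 5)) p+1≡E ⟩
          coverSize (2 + ρ) + (3 * ρ + 5)  ≡⟨ centre-suc ρ ⟩
          centre (suc ρ)                   ∎

    newBall-inside : ∀ ρ {p} → coverSize (2 + ρ) < p → p ≤ centre (suc ρ) →
                     Within Adj (2 + ρ) (centre (suc ρ) ⊖ 0) (p ⊖ 0)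
    newBall-inside ρ {p} E<p p≤c with d , p+d≡c ← m≤n⇒∃[o]m+o≡n p≤c =
      subst (λ b → Within Adj (2 + ρ) (b ⊖ 0) (p ⊖ 0)) p+d≡c (Within-reverse (Within-+ (2 + ρ) d p d+2≤3r))
      where
        open ≤-Reasoning
        d+2≤3r : d + 2 ≤ 3 * (2 + ρ)
        d+2≤3r = begin
          d + 2          ≡⟨ +-comm d 2 ⟩
          2 + d          ≤⟨ s≤s (m<n∧n+o≡m+p⇒o<p E<p (trans p+d≡c (sym (centre-suc ρ)))) ⟩
          1 + (3 * ρ + 5) ≡⟨ solve (ρ ∷ []) ⟩
          3 * (2 + ρ)    ∎

    newBall-beyond : ∀ ρ {p} → centre (suc ρ) ≤ p → suc p < coverSize (3 + ρ) →
                     Within Adj (2 + ρ) (centre (suc ρ) ⊖ 0) (p ⊖ 0)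
    newBall-beyond ρ {p} c≤p p+1<B with d , c+d≡p ← m≤n⇒∃[o]m+o≡n c≤p =
      subst (λ b → Within Adj (2 + ρ) (centre (suc ρ) ⊖ 0) (b ⊖ 0)) c+d≡p (Within-+ (2 + ρ) d (centre (suc ρ)) d+2≤3r)
      where
        open ≤-Reasoning
        c = centre (suc ρ)
        d+2≤3r : d + 2 ≤ 3 * (2 + ρ)
        d+2≤3r = +-cancelˡ-≤ c (d + 2) (3 * (2 + ρ)) (begin
          c + (d + 2)        ≡⟨ +-assoc c d 2 ⟨
          c + d + 2          ≡⟨ cong (_+ 2) c+d≡p ⟩
          p + 2              ≡⟨ +-comm p 2 ⟩
          suc (suc p)        ≤⟨ p+1<B ⟩
          coverSize (3 + ρ)  ≡⟨ centre-reach (suc ρ) ⟨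
          c + (2 + ρ) * 3    ≡⟨ cong (c +_) (*-comm (2 + ρ) 3) ⟩
          c + 3 * (2 + ρ)    ∎)

    burnsBelow : ∀ ρ → Σ (Vec (Fin n) (2 + ρ)) λ xs →
                 lookup xs fzero ≡ centre ρ ⊖ 0 × BurnsBelow (2 + ρ) xs (coverSize (2 + ρ))
    burnsBelow zero = ((3 ⊖ 0) ∷ᵥ (1 ⊖ 0) ∷ᵥ []ᵥ) , refl , burns
      where
        burns : BurnsBelow 2 ((3 ⊖ 0) ∷ᵥ (1 ⊖ 0) ∷ᵥ []ᵥ) 6
        burns 0 _ = fzero , Within-reverse (walk 3 adj₃ 1 0)
        burns 1 _ = fsuc fzero , here
        burns 2 _ = fzero , Within-reverse (walk 1 adj₁ 1 2)
        burns 3 _ = fzero , here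
        burns 4 _ = fzero , walk 1 adj₁ 1 3
        burns (suc (suc (suc (suc (suc p))))) (s≤s (s≤s (s≤s (s≤s (s≤s (s≤s ()))))))
    burnsBelow (suc ρ) with xs , head≡ , burns ← burnsBelow ρ =
      ((centre (suc ρ) ⊖ 0) ∷ᵥ xs) , refl , extend
      where
        extend : BurnsBelow (3 + ρ) ((centre (suc ρ) ⊖ 0) ∷ᵥ xs) (coverSize (3 + ρ))
        extend p p+1<B with <-cmp (suc p) (coverSize (2 + ρ))
        ... | tri< old _ _ = let i , w = burns p old in fsuc i , w
        ... | tri≈ _ p+1≡E _ = fzero , newBall-leftEnd ρ p+1≡E
        ... | tri> _ _ E<p+1 with m≤n⇒m<n∨m≡n (≤-pred E<p+1)
        ...   | inj₂ E≡p = fsuc fzero , subst₂ (Within Adj (suc ρ)) (sym head≡)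
                  (cong (_⊖ 0) (trans (centre-reach ρ) E≡p)) (walk 3 adj₃ (suc ρ) (centre ρ))
        ...   | inj₁ E<p with ≤-total p (centre (suc ρ))
        ...     | inj₁ p≤c = fzero , newBall-inside ρ E<p p≤c
        ...     | inj₂ c≤p = fzero , newBall-beyond ρ c≤p p+1<B

-- Counting the vertices covered by a burning sequence

module _ {A : Set} {N : ℕ} (f : A → Fin N) where

  Covers : List A → Set
  Covers L = ∀ v → Σ A λ a → a ∈ L × f a ≡ v

  Covers⇒≤length : ∀ {L} → Covers L → N ≤ length L
  Covers⇒≤length {L} onto = Fin.injective⇒≤ {f = index} λ {u} {v} eq → begin
    u                          ≡⟨ f-lookup-index u ⟨
    f (List.lookup L (index u)) ≡⟨ cong (f ∘ List.lookup L) eq ⟩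
    f (List.lookup L (index v)) ≡⟨ f-lookup-index v ⟩
    v                          ∎
    where
      open ≡-Reasoning
      index : Fin N → Fin (length L)
      index v = Any.index (proj₁ (proj₂ (onto v)))
      f-lookup-index : ∀ v → f (List.lookup L (index v)) ≡ v
      f-lookup-index v = trans (cong f (sym (lookup-index (proj₁ (proj₂ (onto v)))))) (proj₂ (proj₂ (onto v)))

  -- If a ≢ b, dropping b from L would leave a covering list shorter than N.
  Covers-injective : ∀ {L} → Covers L → length L ≤ N → ∀ {a b} → a ∈ L → b ∈ L → f a ≡ f b → a ≡ b
  Covers-injective {L} onto L≤N {a} {b} a∈L b∈L fa≡fb with ys , zs , refl ← ∈-∃++ b∈L =
    [ (λ a≡b → a≡b) , (λ a∈ys++zs → ⊥-elim (<-irrefl refl (shorter a∈ys++zs))) ]′ (drop-b a∈L)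
    where
      drop-b : ∀ {c} → c ∈ ys ++ b ∷ zs → c ≡ b ⊎ c ∈ ys ++ zs
      drop-b c∈ with ∈-++⁻ ys c∈
      ... | inj₁ c∈ys         = inj₂ (∈-++⁺ˡ c∈ys)
      ... | inj₂ (here c≡b)   = inj₁ c≡b
      ... | inj₂ (there c∈zs) = inj₂ (∈-++⁺ʳ ys c∈zs)
      length-drop : length (ys ++ b ∷ zs) ≡ suc (length (ys ++ zs))
      length-drop = begin
        length (ys ++ b ∷ zs)            ≡⟨ length-++ ys ⟩
        length ys + suc (length zs)      ≡⟨ +-suc (length ys) (length zs) ⟩
        suc (length ys + length zs)      ≡⟨ cong suc (length-++ ys) ⟨
        suc (length (ys ++ zs))          ∎
        where open ≡-Reasoning
      shorter : a ∈ ys ++ zs → N < N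
      shorter a∈ys++zs = begin-strict
        N                          ≤⟨ Covers⇒≤length onto′ ⟩
        length (ys ++ zs)          <⟨ n<1+n _ ⟩
        suc (length (ys ++ zs))    ≡⟨ length-drop ⟨
        length (ys ++ b ∷ zs)      ≤⟨ L≤N ⟩
        N                          ∎
        where
          open ≤-Reasoning
          onto′ : Covers (ys ++ zs)
          onto′ v with c , c∈ , fc≡v ← onto v with drop-b c∈
          ... | inj₁ refl = a , a∈ys++zs , trans fa≡fb fc≡v
          ... | inj₂ c∈′  = c , c∈′ , fc≡v

offsets : ℕ → List ℕ
offsets zero    = 0 ∷ []
offsets (suc r) = 0 ∷ 6 * suc r ∷ applyUpTo (2 +_) (6 * r + 3)

length-offsets : ∀ r → length (offsets r) ≡ ballSize r
length-offsets zero    = refl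
length-offsets (suc r) = begin
  2 + length (applyUpTo (2 +_) (6 * r + 3))  ≡⟨ cong (2 +_) (length-applyUpTo (2 +_) (6 * r + 3)) ⟩
  2 + (6 * r + 3)                           ≡⟨ solve (r ∷ []) ⟩
  6 * r + 5                                 ∎
  where open ≡-Reasoning

Offset⇒∈offsets : ∀ {r t} → Offset r t → t ∈ offsets r
Offset⇒∈offsets {zero}  (leftEnd refl)  = here refl
Offset⇒∈offsets {zero}  (rightEnd refl) = here refl
Offset⇒∈offsets {zero} {t} (inner _ t+2≤0) with () ← m+n≤o⇒n≤o t t+2≤0
Offset⇒∈offsets {suc r} (leftEnd refl)  = here refl
Offset⇒∈offsets {suc r} (rightEnd refl) = there (here refl)
Offset⇒∈offsets {suc r} {suc (suc u)} (inner (s≤s (s≤s z≤n)) u+4≤6r+6) =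
  there (there (∈-applyUpTo⁺ (2 +_) (+-cancelʳ-≤ 3 (suc u) (6 * r + 3) (begin
    suc u + 3      ≡⟨ +-suc (suc u) 2 ⟩
    suc (suc u) + 2 ≤⟨ u+4≤6r+6 ⟩
    6 * suc r      ≡⟨ solve (r ∷ []) ⟩
    6 * r + 3 + 3  ∎))))
  where open ≤-Reasoning

-- (i , t) names the vertex at offset t in the ball of the i-th burned vertex
codes : ∀ k → List (Fin k × ℕ)
codes zero    = []
codes (suc k) = map (fzero ,′_) (offsets k) ++ map (Product.map₁ fsuc) (codes k)

Offset⇒∈codes : ∀ {k} (i : Fin k) {t} → Offset (radius i) t → (i , t) ∈ codes k
Offset⇒∈codes {suc k} fzero    off = ∈-++⁺ˡ (∈-map⁺ (fzero ,′_) (Offset⇒∈offsets off))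
Offset⇒∈codes {suc k} (fsuc i) off = ∈-++⁺ʳ (map (fzero ,′_) (offsets k)) (∈-map⁺ (Product.map₁ fsuc) (Offset⇒∈codes i off))

length-codes : ∀ k → length (codes k) ≡ coverSize k
length-codes zero    = refl
length-codes (suc k) = begin
  length (map (fzero ,′_) (offsets k) ++ map (Product.map₁ fsuc) (codes k))        ≡⟨ length-++ (map (fzero ,′_) (offsets k)) ⟩
  length (map (fzero ,′_) (offsets k)) + length (map (Product.map₁ fsuc) (codes k)) ≡⟨ cong₂ _+_ (length-map (fzero {k} ,′_) (offsets k)) (length-map (Product.map₁ fsuc) (codes k)) ⟩
  length (offsets k) + length (codes k)                                          ≡⟨ cong₂ _+_ (length-offsets k) (length-codes k) ⟩
  ballSize k + coverSize k                                                       ∎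
  where open ≡-Reasoning

module BurningSequence (m : ℕ) {k} (xs : Vec (Fin (suc m)) k) (burning : IsBurningSeq (CircAdj (suc m) S₁₃) k xs) where
  open Cyclic m
  open Circulant m

  -- point and at are opaque so that Agda treats them as rigid when inferring implicit arguments
  opaque
    point : Fin k × ℕ → Fin n
    point (i , t) = toℕ (lookup xs i) + t ⊖ 3 * radius i

    covered : ∀ v → Σ (Fin k × ℕ) λ (i , t) → Offset (radius i) t × point (i , t) ≡ v
    covered v with i , v∈ball ← burning v with t , off , v≡ ← within⇒Offset v∈ball = (i , t) , off , sym v≡

  codes-cover : Covers point (codes k)
  codes-cover v with (i , t) , off , eq ← covered v = (i , t) , Offset⇒∈codes i off , eq

  n≤coverSize : n ≤ coverSize k
  n≤coverSize = subst (n ≤_) (length-codes k) (Covers⇒≤length point codes-cover)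

  point-injective : n ≡ coverSize k → ∀ {i j t u} → Offset (radius i) t → Offset (radius j) u →
                    point (i , t) ≡ point (j , u) → (i , t) ≡ (j , u)
  point-injective tight {i} {j} off off′ =
    Covers-injective point codes-cover (≤-reflexive (trans (length-codes k) (sym tight)))
      (Offset⇒∈codes i off) (Offset⇒∈codes j off′)

module ExactCover (m : ℕ) (6≤m : 6 ≤ m) {k} (xs : Vec (Fin (suc m)) (suc k))
                  (burning : IsBurningSeq (CircAdj (suc m) S₁₃) (suc k) xs)
                  (tight : suc m ≡ coverSize (suc k)) where
  open Cyclic m
  open BurningSequence m xs burning

  last : Fin (suc k)
  last = fromℕ k

  radius-last : radius last ≡ 0
  radius-last = trans (cong (k ∸_) (Fin.toℕ-fromℕ k)) (n∸n≡0 k)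

  radius≡0⇒last : ∀ {i} → radius i ≡ 0 → i ≡ last
  radius≡0⇒last {i} r≡0 =
    Fin.toℕ-injective (trans (≤-antisym (≤-pred (Fin.toℕ<n i)) (m∸n≡0⇒m≤n r≡0)) (sym (Fin.toℕ-fromℕ k)))

  σ : ℕ
  σ = toℕ (lookup xs last)

  -- at j is σ + j − 5, where σ is the centre of the radius-0 ball
  opaque
    at : ℕ → Fin n
    at j = σ + j ⊖ 5

  opaque
    unfolding at point

    at-5 : at 5 ≡ point (last , 0)
    at-5 = ⊖-cong (trans (cong (λ r → σ + 5 + 3 * r) radius-last) (regroup σ))
      where
        regroup : ∀ a → a + 5 + 3 * 0 ≡ a + 0 + 5
        regroup a = solve (a ∷ [])

    at-≢ : ∀ j d → suc d ≤ 6 → at j ≢ at (j + suc d)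
    at-≢ j d d<6 eq =
      ⊖-shift-≢ (σ + j) 5 (suc d) (s≤s (≤-trans d<6 6≤m)) (trans eq (cong (_⊖ 5) (sym (+-assoc σ j (suc d)))))

    at-suc : ∀ {j i t} → at j ≡ point (i , t) → at (suc j) ≡ point (i , suc t)
    at-suc = ⊖-suc

    at-pred : ∀ {j i t} → at (suc j) ≡ point (i , suc t) → at j ≡ point (i , t)
    at-pred = ⊖-pred

  at-back : ∀ d {j i t} → at (d + j) ≡ point (i , d + t) → at j ≡ point (i , t)
  at-back zero    h = h
  at-back (suc d) h = at-back d (at-pred h)

  unique : ∀ {j i t i′ t′} → Offset (radius i) t → Offset (radius i′) t′ →
           at j ≡ point (i , t) → at j ≡ point (i′ , t′) → i ≡ i′ × t ≡ t′
  unique off off′ h h′ with eq ← point-injective tight off off′ (trans (sym h) h′) = ,-injectiveˡ eq , ,-injectiveʳ eq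

  centre-alone : ∀ {i t} → Offset (radius i) t → 1 ≤ radius i → at 5 ≢ point (i , t)
  centre-alone off pos h with refl , _ ← unique off (leftEnd refl) h at-5 with () ← subst (1 ≤_) radius-last pos

  covered-positively : ∀ j → at j ≢ at 5 →
                       Σ (Fin (suc k) × ℕ) λ (i , t) → 1 ≤ radius i × Offset (radius i) t × at j ≡ point (i , t)
  covered-positively j j≢5 with (i , t) , off , eq ← covered (at j) with 1 ≤? radius i
  ... | yes pos = (i , t) , pos , off , sym eq
  ... | no ¬pos = ⊥-elim (j≢5 (begin
    at j             ≡⟨ eq ⟨
    point (i , t)    ≡⟨ cong point (cong₂ _,_ (radius≡0⇒last r≡0) (Offset0⇒t≡0 (subst (λ r → Offset r t) r≡0 off))) ⟩
    point (last , 0) ≡⟨ at-5 ⟨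
    at 5             ∎))
    where
      open ≡-Reasoning
      r≡0 : radius i ≡ 0
      r≡0 = n<1⇒n≡0 (≰⇒> ¬pos)

  NoSpan : ℕ → Set
  NoSpan p = ∀ {i t} → 1 ≤ radius i → Offset (radius i) t → Offset (radius i) (2 + t) → at p ≢ point (i , t)

  ¬leftEnd : ∀ {p i} → 1 ≤ radius i → at (suc p) ≡ point (i , 0) → at (2 + p) ≢ at 5 → NoSpan p → ⊥
  ¬leftEnd {p} {i} pos start 2+p≢5 noSpan
    with (b , t) , pos′ , o , h ← covered-positively (2 + p) 2+p≢5 = go pos′ o (below₂ o) h
    where
      go : ∀ {b t} → 1 ≤ radius b → Offset (radius b) t → Below₂ (radius b) t → at (2 + p) ≡ point (b , t) → ⊥
      go pos′ _ bottom h with () ← proj₂ (unique (Offset-2 pos′) (Offset-3 pos) (at-suc (at-suc h)) (at-suc (at-suc (at-suc start))))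
      go _ o (down₁ o′) h with refl , refl ← unique o′ (leftEnd refl) (at-pred h) start = ¬Offset-1 o
      go pos′ o (down₂ o′) h = noSpan pos′ o′ o (at-pred (at-pred h))

  ¬rightEnd-at-6 : ∀ {i} → 1 ≤ radius i → at 6 ≡ point (i , 6 * radius i) → ⊥
  ¬rightEnd-at-6 {i} pos end with (b , t) , pos′ , o , h ← covered-positively 7 (≢-sym (at-≢ 5 1 (s≤s (s≤s z≤n)))) =
    go pos′ o (below₂ o) h
    where
      noSpan-6 : NoSpan 6
      noSpan-6 _ o o₂ h with refl , refl ← unique o (rightEnd refl) h end = ¬Offset-6r+2 o₂
      go : ∀ {b t} → 1 ≤ radius b → Offset (radius b) t → Below₂ (radius b) t → at 7 ≡ point (b , t) → ⊥
      go pos′ _ bottom h = ¬leftEnd pos′ h (≢-sym (at-≢ 5 2 (s≤s (s≤s (s≤s z≤n))))) noSpan-6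
      go _ o (down₁ o′) h with refl , refl ← unique o′ (rightEnd refl) (at-pred h) end = ¬Offset-6r+1 o
      go pos′ _ (down₂ o′) h = centre-alone o′ pos′ (at-pred (at-pred h))

  ¬twoRightEnds : ∀ {a b} → 1 ≤ radius a → 1 ≤ radius b →
                 at 2 ≡ point (a , 6 * radius a) → at 3 ≡ point (b , 6 * radius b) → ⊥
  ¬twoRightEnds {a} {b} pa pb ha hb = contradiction (unique oa ob ha′ hb′)
    where
      x : ℕ
      x = proj₁ (m≤n⇒∃[o]m+o≡n pa)
      ra : suc x ≡ radius a
      ra = proj₂ (m≤n⇒∃[o]m+o≡n pa)
      y : ℕ
      y = proj₁ (m≤n⇒∃[o]m+o≡n pb)
      rb : suc y ≡ radius b
      rb = proj₂ (m≤n⇒∃[o]m+o≡n pb)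
      oa : Offset (radius a) (4 + 6 * x)
      oa = subst (λ r → Offset r (4 + 6 * x)) ra (Offset-6r-2 x)
      ob : Offset (radius b) (3 + 6 * y)
      ob = subst (λ r → Offset r (3 + 6 * y)) rb (Offset-6r-3 y)
      end-a : 6 * radius a ≡ 2 + (4 + 6 * x)
      end-a = trans (cong (6 *_) (sym ra)) (*-suc 6 x)
      end-b : 6 * radius b ≡ 3 + (3 + 6 * y)
      end-b = trans (cong (6 *_) (sym rb)) (*-suc 6 y)
      ha′ : at 0 ≡ point (a , 4 + 6 * x)
      ha′ = at-back 2 (subst (λ t → at 2 ≡ point (a , t)) end-a ha)
      hb′ : at 0 ≡ point (b , 3 + 6 * y)
      hb′ = at-back 3 (subst (λ t → at 3 ≡ point (b , t)) end-b hb)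
      contradiction : a ≡ b × 4 + 6 * x ≡ 3 + 6 * y → ⊥
      contradiction (a≡b , e) = 1+n≢n (trans (cong (λ z → 4 + 6 * z) y≡x) e)
        where
          y≡x : y ≡ x
          y≡x = suc-injective (trans rb (trans (cong radius (sym a≡b)) (sym ra)))

  ¬rightEnd-at-3 : ∀ {i i′} → at 4 ≡ point (i , 0) → 1 ≤ radius i′ → at 3 ≡ point (i′ , 6 * radius i′) → ⊥
  ¬rightEnd-at-3 {i} {i′} start pos end with (b , t) , pos′ , o , h ← covered-positively 2 (at-≢ 2 2 (s≤s (s≤s (s≤s z≤n)))) =
    go pos′ o (above₂ o) h
    where
      go : ∀ {b t} → 1 ≤ radius b → Offset (radius b) t → Above₂ (radius b) t → at 2 ≡ point (b , t) → ⊥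
      go pos′ _ (top refl) h = ¬twoRightEnds pos′ pos h end
      go _ o (up₁ o′) h with refl , e ← unique o′ (rightEnd refl) (at-suc h) end = Offset⇒suc≢6r o e
      go _ _ (up₂ o′) h with () ← proj₂ (unique o′ (leftEnd refl) (at-suc (at-suc h)) start)

  ¬gap-at-6 : ∀ {i} → 1 ≤ radius i → at 6 ≡ point (i , 2) → ⊥
  ¬gap-at-6 {i} pos gap with (b , t) , pos′ , o , h ← covered-positively 3 (at-≢ 3 1 (s≤s (s≤s z≤n))) =
    go pos′ o (above₂ o) h
    where
      start : at 4 ≡ point (i , 0)
      start = at-pred (at-pred gap)
      go : ∀ {b t} → 1 ≤ radius b → Offset (radius b) t → Above₂ (radius b) t → at 3 ≡ point (b , t) → ⊥
      go pos′ _ (top refl) h = ¬rightEnd-at-3 start pos′ h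
      go _ _ (up₁ o′) h with () ← proj₂ (unique o′ (leftEnd refl) (at-suc h) start)
      go pos′ _ (up₂ o′) h = centre-alone o′ pos′ (at-suc (at-suc h))

  impossible : ⊥
  impossible with (b , t) , pos , o , h ← covered-positively 6 (≢-sym (at-≢ 5 0 (s≤s z≤n))) = go pos o (below₁ o) h
    where
      go : ∀ {b t} → 1 ≤ radius b → Offset (radius b) t → Below₁ (radius b) t → at 6 ≡ point (b , t) → ⊥
      go pos _ atLeftEnd  h = ¬leftEnd pos h (≢-sym (at-≢ 5 1 (s≤s (s≤s z≤n)))) (λ pos′ o _ → centre-alone o pos′)
      go pos _ atGap      h = ¬gap-at-6 pos h
      go pos _ atRightEnd h = ¬rightEnd-at-6 pos h
      go pos _ (down₁ o)  h = centre-alone o pos (at-pred h)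

-- The burning number

isqrt-spec : ∀ N → isqrt N * isqrt N ≤ N × N < suc (isqrt N) * suc (isqrt N)
isqrt-spec zero = z≤n , s≤s z≤n
-- the test suc s * suc s ≤? suc N in isqrt reduces to the boolean s + s * suc s <ᵇ suc N
isqrt-spec (suc N) with isqrt N | isqrt-spec N
... | s | s²≤N , N<[s+1]² with s + s * suc s <ᵇ suc N in test
...   | true  = <ᵇ⇒< (s + s * suc s) (suc N) (subst T (sym test) _) , (begin-strict
  suc N                     ≤⟨ N<[s+1]² ⟩
  suc s * suc s             <⟨ m+o≡n⇒m≤n (2 * s + 2) (solve (s ∷ [])) ⟩
  suc (suc s) * suc (suc s) ∎)
  where open ≤-Reasoning
...   | false = ≤-trans s²≤N (n≤1+n N) , ≰⇒> (λ [s+1]²≤N+1 → subst T test (<⇒<ᵇ [s+1]²≤N+1))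

three-coverSize : ∀ q → 3 * coverSize (suc q) ≡ (3 * q + 1) * (3 * q + 1) + 2
three-coverSize q = begin
  3 * coverSize (suc q)              ≡⟨ cong (3 *_) (coverSize-closed q) ⟩
  3 * (3 * q * q + 2 * q + 1)        ≡⟨ solve (q ∷ []) ⟩
  (3 * q + 1) * (3 * q + 1) + 2      ∎
  where open ≡-Reasoning

coverSize-bracket : ∀ n → 1 ≤ n → let q = (2 + isqrt (3 * n ∸ 2)) / 3 in
                    coverSize q ≤ n × n < coverSize (suc q)
coverSize-bracket n 1≤n = lower ((2 + s) / 3) (m/n*n≤m (2 + s) 3) , upper
  where
    N : ℕ
    N = 3 * n ∸ 2
    s : ℕ
    s = isqrt N
    q : ℕ
    q = (2 + s) / 3
    N+2≡3n : N + 2 ≡ 3 * n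
    N+2≡3n = m∸n+n≡m (≤-trans (s≤s (s≤s z≤n)) (*-monoʳ-≤ 3 1≤n))
    regroup : ∀ x → 3 * x + 1 ≡ suc (x * 3)
    regroup x = solve (x ∷ [])
    s+1≤3q+1 : suc s ≤ 3 * q + 1
    s+1≤3q+1 = ≤-trans (+-cancelˡ-≤ 2 (suc s) (suc (q * 3)) (begin
      3 + s                   ≡⟨ cong suc (m≡m%n+[m/n]*n (2 + s) 3) ⟩
      suc ((2 + s) % 3 + q * 3) ≤⟨ +-monoˡ-< (q * 3) (m%n<n (2 + s) 3) ⟩
      3 + q * 3               ∎)) (≤-reflexive (sym (regroup q)))
      where open ≤-Reasoning
    lower : ∀ q → q * 3 ≤ 2 + s → coverSize q ≤ n
    lower zero    _        = z≤n
    lower (suc q) 3q+3≤2+s = *-cancelˡ-≤ 3 (begin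
      3 * coverSize (suc q)          ≡⟨ three-coverSize q ⟩
      (3 * q + 1) * (3 * q + 1) + 2  ≤⟨ +-monoˡ-≤ 2 (*-mono-≤ 3q+1≤s 3q+1≤s) ⟩
      s * s + 2                      ≤⟨ +-monoˡ-≤ 2 (proj₁ (isqrt-spec N)) ⟩
      N + 2                          ≡⟨ N+2≡3n ⟩
      3 * n                          ∎)
      where
        open ≤-Reasoning
        3q+1≤s : 3 * q + 1 ≤ s
        3q+1≤s = ≤-trans (≤-reflexive (regroup q)) (+-cancelˡ-≤ 2 (suc (q * 3)) s 3q+3≤2+s)
    upper : n < coverSize (suc q)
    upper = *-cancelˡ-< 3 n (coverSize (suc q)) (begin-strict
      3 * n                          ≡⟨ N+2≡3n ⟨
      N + 2                          <⟨ +-monoˡ-< 2 (proj₂ (isqrt-spec N)) ⟩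
      suc s * suc s + 2              ≤⟨ +-monoˡ-≤ 2 (*-mono-≤ s+1≤3q+1 s+1≤3q+1) ⟩
      (3 * q + 1) * (3 * q + 1) + 2  ≡⟨ three-coverSize q ⟨
      3 * coverSize (suc q)          ∎)
      where open ≤-Reasoning

module BurningNumber (m : ℕ) (6≤m : 6 ≤ m) where
  open Cyclic m
  open Circulant m

  burning⇒n<coverSize : ∀ {k} (xs : Vec (Fin n) k) → IsBurningSeq Adj k xs → n < coverSize k
  burning⇒n<coverSize {zero}  xs burning with () ← proj₁ (burning fzero)
  burning⇒n<coverSize {suc k} xs burning with m≤n⇒m<n∨m≡n (BurningSequence.n≤coverSize m xs burning)
  ... | inj₁ n<G = n<G
  ... | inj₂ n≡G = ⊥-elim (ExactCover.impossible m 6≤m xs burning n≡G)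

  burningSeq : ∀ ρ → n < coverSize (2 + ρ) → Σ (Vec (Fin n) (2 + ρ)) (IsBurningSeq Adj (2 + ρ))
  burningSeq ρ n<G with xs , _ , burns ← burnsBelow 6≤m ρ =
    xs , λ v → Product.map₂ (subst (Within Adj _ _) (toℕ⊖0 v)) (burns (toℕ v) (≤-trans (s≤s (Fin.toℕ<n v)) n<G))

  isBurningNumber : ∀ q → coverSize q ≤ n → n < coverSize (suc q) → IsBurningNumber Adj (q + 1)
  isBurningNumber zero    _   (s≤s ())
  isBurningNumber (suc ρ) G≤n n<G′ =
    subst (IsBurningNumber Adj) (+-comm 1 (suc ρ)) (burningSeq ρ n<G′ , minimal)
    where
      minimal : ∀ k xs → IsBurningSeq Adj k xs → 2 + ρ ≤ k
      minimal k xs burning = ≮⇒≥ λ k<2+ρ →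
        <⇒≱ (burning⇒n<coverSize xs burning) (≤-trans (coverSize-mono (≤-pred k<2+ρ)) G≤n)

mainTheorem12 : (n : ℕ) → 7 ≤ n →
    IsBurningNumber (CircAdj n (1 ∷ 3 ∷ [])) ((2 + isqrt (3 * n ∸ 2)) / 3 + 1)
mainTheorem12 (suc m) (s≤s 6≤m) with G≤n , n<G′ ← coverSize-bracket (suc m) (s≤s z≤n) =
  BurningNumber.isBurningNumber m 6≤m _ G≤n n<G′
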